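{- Let $\mathcal{F}\subseteq\mathcal{T}$ be a class of functions that contains the initial functions and is closed under substitution and bounded minimization. Then the pair $(\mathcal{F},\mathbf{O}_\mathcal{F})$ is acceptable.
   Context: $\mathbb{N}$ is the set of non-negative integers; $\mathcal{T}_m$ is the set of all total functions $\mathbb{N}^m\to\mathbb{N}$, $\mathcal{T}=\bigcup_m\mathcal{T}_m$. An $n$-operator is a mapping $\mathcal{T}_1^n\to\mathcal{T}_1$. $g\in\mathcal{T}_m$ majorizes $f\in\mathcal{T}_m$ if $f\le g$ pointwise. The initial functions are all projections, the successor, multiplication, modified subtraction $\lambda xy.\max(x-y,0)$ and $\lambda xy.\lfloor x/(y+1)\rfloor$. Bounded minimization produces from $f\in\mathcal{T}_{k+1}$ the function $g(\vec x,y)$ equal to the least $z\le y$ with $f(\vec x,z)=0$ if it exists, and $y+1$ otherwise. A pair $(\mathcal{F},\mathbf{O})$ ($\mathcal{F}\subseteq\mathcal{T}$, $\mathbf{O}$ a class of operators) is acceptable if: (1) the initial functions are in $\mathcal{F}$; (2) $\mathcal{F}$ is closed under substitution and bounded minimization; (3) every $n$-operator $F\in\mathbf{O}$ is continuous: for all $f_1,\dots,f_n\in\mathcal{T}_1$ and $x$ there is $z$ such that $F(\vec g)(x)=F(\vec f)(x)$ whenever $g_i(t)=f_i(t)$ for all $t\le z$ and all $i$; (4) for each $n$, the $n$-operator $F(\vec f)(x)=x$ is in $\mathbf{O}$; (5) if $n$-operator $F_0\in\mathbf{O}$ and $1\le j\le n$, then $F(\vec f)(x)=f_j(F_0(\vec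 f)(x))$ is in $\mathbf{O}$; (6) if $a\in\mathcal{T}_m\cap\mathcal{F}$ and $n$-operators $F_1,\dots,F_m\in\mathbf{O}$, then $F(\vec f)(x)=a(F_1(\vec f)(x),\dots,F_m(\vec f)(x))$ is in $\mathbf{O}$; (7) if $F$ is a $k$-operator in $\mathbf{O}$ and $G_1,\dots,G_k$ are $n$-operators in $\mathbf{O}$, then the $n$-operator $H(\vec f)=F(G_1(\vec f),\dots,G_k(\vec f))$ is in $\mathbf{O}$; (8) if $f_1,\dots,f_n\in\mathcal{T}_{m+1}\cap\mathcal{F}$ and $F$ is an $n$-operator in $\mathbf{O}$, then $a(\vec s,x)=F(\lambda t.f_1(\vec s,t),\dots,\lambda t.f_n(\vec s,t))(x)$ is in $\mathcal{F}$; (9) for every $n$-operator $F\in\mathbf{O}$ there is a $1$-operator $\Omega\in\mathbf{O}$ such that for all $x$ and every monotonically increasing $g\in\mathcal{T}_1$, if $f_1,\dots,f_n,f_1',\dots,f_n'\in\mathcal{T}_1$ are majorized by $g$ and $f_i(t)=f_i'(t)$ for all $i$ and all $t\le\Omega(g)(x)$, then $F(f_1,\dots,f_n)(x)=F(f_1',\dots,f_n')(x)$. $\mathbf{O}_\mathcal{F}$ denotes the least class of operators satisfying conditions (4), (5), (6) above (with $\mathbf{O}_\mathcal{F}$ in place of $\mathbf{O}$). -}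

module Defs where

open import Data.Nat using (ℕ; zero; suc; _*_; _∸_; _≤_; _≟_)
open import Data.Nat.DivMod using (_/_)
open import Data.Fin using (Fin; zero; suc)
open import Data.Vec using (Vec; lookup; tabulate; init; last; _∷ʳ_)
open import Data.Product using (Σ; _×_)
open import Relation.Nullary using (yes; no)
open import Relation.Binary.PropositionalEquality using (_≡_)

-- 𝒯_m : total functions ℕ^m → ℕ (ℕ^m rendered as Vec ℕ m)
T : ℕ → Set
T m = Vec ℕ m → ℕ

-- an n-operator : 𝒯_1^n → 𝒯_1  (unary functions rendered as ℕ → ℕ)
Op : ℕ → Set
Op n = (Fin n → ℕ → ℕ) → ℕ → ℕ

FunClass : Set₁
FunClass = (m : ℕ) → T m → Set

OpClass : Set₁
OpClass = (n : ℕ) → Op n → Set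

-- a class of functions is a set of (extensional) functions
Extensional : FunClass → Set
Extensional 𝓕 = ∀ m (f g : T m) → (∀ xs → f xs ≡ g xs) → 𝓕 m f → 𝓕 m g

proj : (m : ℕ) → Fin m → T m
proj m i v = lookup v i

succF : T 1
succF v = suc (lookup v zero)

multF : T 2
multF v = lookup v zero * lookup v (suc zero)

monusF : T 2
monusF v = lookup v zero ∸ lookup v (suc zero)

divF : T 2
divF v = lookup v zero / suc (lookup v (suc zero))

InitialIn : FunClass → Set
InitialIn 𝓕 = (∀ m (i : Fin m) → 𝓕 m (proj m i))
            × 𝓕 1 succF × 𝓕 2 multF × 𝓕 2 monusF × 𝓕 2 divF

subst : ∀ {k m} → T k → (Fin k → T m) → T m
subst f gs v = f (tabulate (λ i → gs i v))

ClosedSubst : FunClass → Set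
ClosedSubst 𝓕 = ∀ k m (f : T k) (gs : Fin k → T m) →
  𝓕 k f → (∀ i → 𝓕 m (gs i)) → 𝓕 m (subst f gs)

bmin-from : (ℕ → ℕ) → ℕ → ℕ → ℕ
bmin-from p z zero = z
bmin-from p z (suc r) with p z ≟ 0
... | yes _ = z
... | no _ = bmin-from p (suc z) r

-- μ z ≤ y . p z = 0   (value y+1 if no such z)
bmin : (ℕ → ℕ) → ℕ → ℕ
bmin p y = bmin-from p 0 (suc y)

bminimize : ∀ {k} → T (suc k) → T (suc k)
bminimize f v = bmin (λ z → f (init v ∷ʳ z)) (last v)

ClosedBMin : FunClass → Set
ClosedBMin 𝓕 = ∀ k (f : T (suc k)) → 𝓕 (suc k) f → 𝓕 (suc k) (bminimize f)

Agree≤ : ∀ {n} → ℕ → (Fin n → ℕ → ℕ) → (Fin n → ℕ → ℕ) → Set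
Agree≤ z gs fs = ∀ i t → t ≤ z → gs i t ≡ fs i t

Continuous : ∀ {n} → Op n → Set
Continuous F = ∀ fs x → Σ ℕ λ z → ∀ gs → Agree≤ z gs fs → F gs x ≡ F fs x

Monotone : (ℕ → ℕ) → Set
Monotone g = ∀ {x y} → x ≤ y → g x ≤ g y

Majorized : ∀ {n} → (Fin n → ℕ → ℕ) → (ℕ → ℕ) → Set
Majorized fs g = ∀ i t → fs i t ≤ g t

record Acceptable (𝓕 : FunClass) (𝐎 : OpClass) : Set₁ where
  field
    c1 : InitialIn 𝓕
    c2-subst : ClosedSubst 𝓕
    c2-bmin : ClosedBMin 𝓕
    c3 : ∀ n (F : Op n) → 𝐎 n F → Continuous F
    c4 : ∀ n → 𝐎 n (λ fs x → x)
    c5 : ∀ n (F₀ : Op n) (j : Fin n) → 𝐎 n F₀ → 𝐎 n (λ fs x → fs j (F₀ fs x))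
    c6 : ∀ m n (a : T m) (Fs : Fin m → Op n) → 𝓕 m a → (∀ i → 𝐎 n (Fs i)) →
         𝐎 n (λ fs x → a (tabulate (λ i → Fs i fs x)))
    c7 : ∀ k n (F : Op k) (Gs : Fin k → Op n) → 𝐎 k F → (∀ i → 𝐎 n (Gs i)) →
         𝐎 n (λ fs → F (λ i → Gs i fs))
    c8 : ∀ m n (fs : Fin n → T (suc m)) (F : Op n) → (∀ i → 𝓕 (suc m) (fs i)) → 𝐎 n F →
         𝓕 (suc m) (λ v → F (λ i t → fs i (init v ∷ʳ t)) (last v))
    c9 : ∀ n (F : Op n) → 𝐎 n F → Σ (Op 1) λ Ω → 𝐎 1 Ω ×
         (∀ x (g : ℕ → ℕ) → Monotone g → (fs fs′ : Fin n → ℕ → ℕ) →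
           Majorized fs g → Majorized fs′ g →
           Agree≤ (Ω (λ _ → g) x) fs fs′ → F fs x ≡ F fs′ x)

-- 𝐎_𝓕 : least class of operators satisfying (4),(5),(6)
-- (as a class of operators = set of maps, it is closed under
--  extensional equality of operators)

data O[_] (𝓕 : FunClass) : OpClass where
  o-id : ∀ {n} → O[ 𝓕 ] n (λ fs x → x)
  o-app : ∀ {n} {F₀ : Op n} (j : Fin n) → O[ 𝓕 ] n F₀ →
          O[ 𝓕 ] n (λ fs x → fs j (F₀ fs x))
  o-sub : ∀ {m n} (a : T m) {Fs : Fin m → Op n} → 𝓕 m a → (∀ i → O[ 𝓕 ] n (Fs i)) →
          O[ 𝓕 ] n (λ fs x → a (tabulate (λ i → Fs i fs x)))
  o-ext : ∀ {n} {F G : Op n} → O[ 𝓕 ] n F → (∀ fs x → F fs x ≡ G fs x) → O[ 𝓕 ] n G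

module Submission where

-- Conditions (1), (2) are hypotheses and (4)-(6) are the constructors of
-- 𝐎_𝓕.  The remaining conditions are proved by induction on the derivation
-- of an operator in 𝐎_𝓕:
--  * (3) continuity and (7) closure under composition hold for any 𝓕;
--  * (8) needs that 𝓕 is closed under explicit transformations of the
--    arguments (the module Closure);
--  * (9) is proved together with a bound: for every F we build operators
--    Ω and B of 𝐎_𝓕 such that, for f⃗ majorised by a monotone g, the value
--    F(f⃗)(x) is at most B(g)(x) and is determined by f⃗ on [0, Ω(g)(x)].
--    Bounding a(F₁(f⃗)(x), …, Fₘ(f⃗)(x)) requires a majorant of a ∈ 𝓕 which
--    is monotone on boxes; it is obtained by maximising a coordinate by
--    coordinate, and bounded maximisation is expressed by two nested
--    bounded minimisations.

open import Defs
open import Data.Nat using (ℕ; zero; suc; _+_; _*_; _∸_; _≤_; _<_; z≤n; s≤s; _≟_)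
open import Data.Nat.Properties
open import Data.Fin using (Fin; zero; suc; inject₁; fromℕ)
open import Data.Fin.Properties using () renaming (_≟_ to _≟ᶠ_)
open import Data.Vec using (Vec; []; _∷_; lookup; tabulate; init; last; _∷ʳ_; _[_]≔_)
open import Data.Vec.Properties
  using (init-∷ʳ; last-∷ʳ; tabulate∘lookup; lookup∘tabulate; tabulate-cong; lookup∘update; lookup∘update′)
open import Data.List using (List; []; _∷_; upTo; allFin)
import Data.List.Relation.Unary.All as All
open import Data.List.Relation.Unary.All.Properties using (all-upTo)
open import Data.List.Relation.Unary.Any using (here; there)
open import Data.List.Membership.Propositional using (_∈_)
open import Data.List.Membership.Propositional.Properties using (∈-upTo⁺; ∈-allFin)
import Data.List.Extrema.Nat as Extrema
open import Data.Product using (Σ; _×_; _,_; proj₁; proj₂)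
open import Data.Sum using (_⊎_; inj₁; inj₂)
open import Data.Empty using (⊥-elim)
open import Relation.Nullary using (yes; no)
open import Relation.Binary.PropositionalEquality
  using (_≡_; _≢_; refl; sym; trans; cong; cong₂; module ≡-Reasoning)
  renaming (subst to ≡-subst)

bmin-from-cong : ∀ {p q : ℕ → ℕ} → (∀ z → p z ≡ q z) → ∀ z r → bmin-from p z r ≡ bmin-from q z r
bmin-from-cong e z zero = refl
bmin-from-cong {p} {q} e z (suc r) with p z ≟ 0 | q z ≟ 0
... | yes _  | yes _  = refl
... | yes pz | no qz  = ⊥-elim (qz (trans (sym (e z)) pz))
... | no pz  | yes qz = ⊥-elim (pz (trans (e z) qz))
... | no _   | no _   = bmin-from-cong e (suc z) r

bmin-cong : ∀ {p q : ℕ → ℕ} → (∀ z → p z ≡ q z) → ∀ y → bmin p y ≡ bmin q y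
bmin-cong e y = bmin-from-cong e 0 (suc y)

bmin-from-found : ∀ p z r → bmin-from p z r < z + r → p (bmin-from p z r) ≡ 0
bmin-from-found p z zero stop = ⊥-elim (<-irrefl (sym (+-identityʳ z)) stop)
bmin-from-found p z (suc r) stop with p z ≟ 0
... | yes pz = pz
... | no _   = bmin-from-found p (suc z) r (≡-subst (bmin-from p (suc z) r <_) (+-suc z r) stop)

bmin-from-least : ∀ p z r t → p t ≡ 0 → z ≤ t → t < z + r → bmin-from p z r ≤ t
bmin-from-least p z zero t _ z≤t t<z+0 = ⊥-elim (<⇒≱ (≡-subst (t <_) (+-identityʳ z) t<z+0) z≤t)
bmin-from-least p z (suc r) t pt z≤t t<end with p z ≟ 0
... | yes _ = z≤t
... | no pz with m≤n⇒m<n∨m≡n z≤t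
...   | inj₂ refl = ⊥-elim (pz pt)
...   | inj₁ z<t  = bmin-from-least p (suc z) r t pt z<t (≡-subst (t <_) (+-suc z r) t<end)

bmin-from-none : ∀ p z r → (∀ t → z ≤ t → t < z + r → p t ≢ 0) → bmin-from p z r ≡ z + r
bmin-from-none p z zero _ = sym (+-identityʳ z)
bmin-from-none p z (suc r) none with p z ≟ 0
... | yes pz = ⊥-elim (none z ≤-refl (≡-subst (z <_) (sym (+-suc z r)) (s≤s (m≤m+n z r))) pz)
... | no _   = trans (bmin-from-none p (suc z) r none′) (sym (+-suc z r))
  where
  none′ : ∀ t → suc z ≤ t → t < suc z + r → p t ≢ 0
  none′ t z<t t<end = none t (<⇒≤ z<t) (≡-subst (t <_) (sym (+-suc z r)) t<end)

bmin-found : ∀ p y → bmin p y ≤ y → p (bmin p y) ≡ 0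
bmin-found p y stop = bmin-from-found p 0 (suc y) (s≤s stop)

bmin-least : ∀ p y t → p t ≡ 0 → t ≤ y → bmin p y ≤ t
bmin-least p y t pt t≤y = bmin-from-least p 0 (suc y) t pt z≤n (s≤s t≤y)

bmin-none : ∀ p y → (∀ t → t ≤ y → p t ≢ 0) → bmin p y ≡ suc y
bmin-none p y none = bmin-from-none p 0 (suc y) (λ t _ t≤y → none t (≤-pred t≤y))

-- exceeds F z y is zero exactly when F y > F z.
exceeds : (ℕ → ℕ) → ℕ → ℕ → ℕ
exceeds F z y = 1 ∸ (F y ∸ F z)

exceeds-≢0 : ∀ F z y → exceeds F z y ≢ 0 → F y ≤ F z
exceeds-≢0 F z y ≢0 = m∸n≡0⇒m≤n (1∸n≢0⇒n≡0 (F y ∸ F z) ≢0)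
  where
  1∸n≢0⇒n≡0 : ∀ n → 1 ∸ n ≢ 0 → n ≡ 0
  1∸n≢0⇒n≡0 zero    _   = refl
  1∸n≢0⇒n≡0 (suc n) ≢0 = ⊥-elim (≢0 (0∸n≡0 n))

≤⇒exceeds-≢0 : ∀ F z y → F y ≤ F z → exceeds F z y ≢ 0
≤⇒exceeds-≢0 F z y Fy≤Fz ≡0 = 1+n≢0 (trans (cong (1 ∸_) (sym (m≤n⇒m∸n≡0 Fy≤Fz))) ≡0)

-- notMaximal F w z is zero exactly when no y ≤ w has F y > F z.
notMaximal : (ℕ → ℕ) → ℕ → ℕ → ℕ
notMaximal F w z = suc w ∸ bmin (exceeds F z) w

-- A point of [0, w] where F is maximal, found by bounded minimisations only.
argmax : (ℕ → ℕ) → ℕ → ℕ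
argmax F w = bmin (notMaximal F w) w

maximiser : ∀ (F : ℕ → ℕ) w → Σ ℕ λ z → z ≤ w × (∀ y → y ≤ w → F y ≤ F z)
maximiser F w =
  z , Extrema.argmax-all F z≤n (All.map ≤-pred (all-upTo (suc w))) ,
  λ y y≤w → All.lookup (Extrema.f[xs]≤f[argmax] {f = F} 0 (upTo (suc w))) (∈-upTo⁺ (s≤s y≤w))
  where z = Extrema.argmax F 0 (upTo (suc w))

argmax-max : ∀ F w y → y ≤ w → F y ≤ F (argmax F w)
argmax-max F w y y≤w = exceeds-≢0 F (argmax F w) y exceeded
  where
  z₀ : ℕ
  z₀ = proj₁ (maximiser F w)
  z₀≤w : z₀ ≤ w
  z₀≤w = proj₁ (proj₂ (maximiser F w))
  z₀-max : ∀ t → t ≤ w → F t ≤ F z₀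
  z₀-max = proj₂ (proj₂ (maximiser F w))
  -- a true maximiser witnesses that the search for argmax stops within [0, w]
  z₀-maximal : notMaximal F w z₀ ≡ 0
  z₀-maximal = trans (cong (suc w ∸_) (bmin-none (exceeds F z₀) w λ t t≤w → ≤⇒exceeds-≢0 F z₀ t (z₀-max t t≤w)))
                     (n∸n≡0 (suc w))
  argmax≤w : argmax F w ≤ w
  argmax≤w = ≤-trans (bmin-least (notMaximal F w) w z₀ z₀-maximal z₀≤w) z₀≤w
  nothing-exceeds : suc w ≤ bmin (exceeds F (argmax F w)) w
  nothing-exceeds = m∸n≡0⇒m≤n (bmin-found (notMaximal F w) w argmax≤w)
  exceeded : exceeds F (argmax F w) y ≢ 0
  exceeded ≡0 = <⇒≱ (s≤s y≤w) (≤-trans nothing-exceeds (bmin-least (exceeds F (argmax F w)) w y ≡0 y≤w))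

lookup-∷ʳ-inject₁ : ∀ {A : Set} {k} (u : Vec A k) y j → lookup (u ∷ʳ y) (inject₁ j) ≡ lookup u j
lookup-∷ʳ-inject₁ (x ∷ u) y zero    = refl
lookup-∷ʳ-inject₁ (x ∷ u) y (suc j) = lookup-∷ʳ-inject₁ u y j

lookup-∷ʳ-fromℕ : ∀ {A : Set} {k} (u : Vec A k) y → lookup (u ∷ʳ y) (fromℕ k) ≡ y
lookup-∷ʳ-fromℕ []      y = refl
lookup-∷ʳ-fromℕ (x ∷ u) y = lookup-∷ʳ-fromℕ u y

lookup-init : ∀ {A : Set} {k} (v : Vec A (suc k)) j → lookup (init v) j ≡ lookup v (inject₁ j)
lookup-init (x ∷ v) zero    = refl
lookup-init (x ∷ v) (suc j) = lookup-init v j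

last-lookup : ∀ {A : Set} {k} (v : Vec A (suc k)) → last v ≡ lookup v (fromℕ k)
last-lookup (x ∷ [])    = refl
last-lookup (x ∷ y ∷ v) = last-lookup (y ∷ v)

data LastOrInit {k : ℕ} : Fin (suc k) → Set where
  is-last : LastOrInit (fromℕ k)
  is-init : (j : Fin k) → LastOrInit (inject₁ j)

lastOrInit : ∀ {k} (j : Fin (suc k)) → LastOrInit j
lastOrInit {zero}  zero    = is-last
lastOrInit {suc k} zero    = is-init zero
lastOrInit {suc k} (suc j) with lastOrInit j
... | is-last   = is-last
... | is-init i = is-init (suc i)

vec-ext : ∀ {A : Set} {k} (u v : Vec A k) → (∀ j → lookup u j ≡ lookup v j) → u ≡ v
vec-ext u v same = begin
  u                  ≡⟨ sym (tabulate∘lookup u) ⟩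
  tabulate (lookup u) ≡⟨ tabulate-cong same ⟩
  tabulate (lookup v) ≡⟨ tabulate∘lookup v ⟩
  v                  ∎
  where open ≡-Reasoning

_≤ᵛ_ : ∀ {m} → Vec ℕ m → Vec ℕ m → Set
w ≤ᵛ v = ∀ i → lookup w i ≤ lookup v i

tabulate-≤ᵛ : ∀ {m} {f g : Fin m → ℕ} → (∀ i → f i ≤ g i) → tabulate f ≤ᵛ tabulate g
tabulate-≤ᵛ {f = f} {g} f≤g i =
  ≤-trans (≤-reflexive (lookup∘tabulate f i)) (≤-trans (f≤g i) (≤-reflexive (sym (lookup∘tabulate g i))))

≤ᵛ-update : ∀ {m} (w v : Vec ℕ m) i → w ≤ᵛ v → w ≤ᵛ (v [ i ]≔ lookup w i)
≤ᵛ-update w v i w≤v j with j ≟ᶠ i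
... | yes refl = ≤-reflexive (sym (lookup∘update j v (lookup w j)))
... | no j≢i   = ≤-trans (w≤v j) (≤-reflexive (sym (lookup∘update′ j≢i v (lookup w i))))

DiffersOnlyOn : ∀ {m} → List (Fin m) → Vec ℕ m → Vec ℕ m → Set
DiffersOnlyOn L w v = ∀ j → j ∈ L ⊎ lookup w j ≡ lookup v j

differs-update : ∀ {m} (w v : Vec ℕ m) i L → DiffersOnlyOn (i ∷ L) w v → DiffersOnlyOn L w (v [ i ]≔ lookup w i)
differs-update w v i L diff j with j ≟ᶠ i
... | yes refl = inj₂ (sym (lookup∘update j v (lookup w j)))
... | no j≢i with diff j
...   | inj₁ (here j≡i) = ⊥-elim (j≢i j≡i)
...   | inj₁ (there j∈L) = inj₁ j∈L
...   | inj₂ same = inj₂ (trans same (sym (lookup∘update′ j≢i v (lookup w i))))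

differs-none : ∀ {m} {w v : Vec ℕ m} → DiffersOnlyOn [] w v → w ≡ v
differs-none {w = w} {v} diff = vec-ext w v same
  where
  same : ∀ j → lookup w j ≡ lookup v j
  same j with diff j
  ... | inj₂ eq = eq

-- cover a b = (a+1)(b+1) bounds a and b and is built from initial functions.
cover : ℕ → ℕ → ℕ
cover a b = suc a * suc b

cover-≥ˡ : ∀ a b → a ≤ cover a b
cover-≥ˡ a b = ≤-trans (n≤1+n a) (m≤m*n (suc a) (suc b))

cover-≥ʳ : ∀ a b → b ≤ cover a b
cover-≥ʳ a b = ≤-trans (n≤1+n b) (m≤n*m (suc b) (suc a))

coverAll : ∀ {m} → ℕ → (Fin m → ℕ) → ℕ
coverAll {zero}  x f = x
coverAll {suc m} x f = cover (f zero) (coverAll x (λ i → f (suc i)))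

coverAll-≥ : ∀ {m} x (f : Fin m → ℕ) i → f i ≤ coverAll x f
coverAll-≥ x f zero    = cover-≥ˡ (f zero) _
coverAll-≥ x f (suc i) = ≤-trans (coverAll-≥ x (λ i → f (suc i)) i) (cover-≥ʳ (f zero) _)

agree-≤ : ∀ {n} {z z′ : ℕ} {gs fs : Fin n → ℕ → ℕ} → z ≤ z′ → Agree≤ z′ gs fs → Agree≤ z gs fs
agree-≤ z≤z′ agree i t t≤z = agree i t (≤-trans t≤z z≤z′)

Family : ℕ → Set
Family m = Vec ℕ m → ℕ → ℕ

uncurryʳ : ∀ {m} → Family m → T (suc m)
uncurryʳ G u = G (init u) (last u)

uncurryʳ-∷ʳ : ∀ {m} (G : Family m) v y → uncurryʳ G (v ∷ʳ y) ≡ G v y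
uncurryʳ-∷ʳ G v y = cong₂ G (init-∷ʳ y v) (last-∷ʳ y v)

module _ {𝓕 : FunClass} where

  continuous : ∀ {n} {F : Op n} → O[ 𝓕 ] n F → Continuous F
  continuous o-id fs x = 0 , λ _ _ → refl
  continuous (o-app {F₀ = F₀} j o) fs x with continuous o fs x
  ... | z , determined = cover z (F₀ fs x) , λ gs agree → begin
    gs j (F₀ gs x) ≡⟨ cong (gs j) (determined gs (agree-≤ (cover-≥ˡ z _) agree)) ⟩
    gs j (F₀ fs x) ≡⟨ agree j (F₀ fs x) (cover-≥ʳ z _) ⟩
    fs j (F₀ fs x) ∎
    where open ≡-Reasoning
  continuous (o-sub {m} a _ os) fs x = coverAll 0 zs , λ gs agree →
    cong a (tabulate-cong λ i → proj₂ (continuous (os i) fs x) gs (agree-≤ (coverAll-≥ 0 zs i) agree))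
    where
    zs : Fin m → ℕ
    zs i = proj₁ (continuous (os i) fs x)
  continuous (o-ext o e) fs x with continuous o fs x
  ... | z , determined = z , λ gs agree → trans (sym (e gs x)) (trans (determined gs agree) (e fs x))

  sequence : ∀ {n} {G H : Op n} → O[ 𝓕 ] n G → O[ 𝓕 ] n H → O[ 𝓕 ] n (λ fs x → G fs (H fs x))
  sequence o-id            oH = oH
  sequence (o-app j oG)    oH = o-app j (sequence oG oH)
  sequence (o-sub a a∈ os) oH = o-sub a a∈ (λ i → sequence (os i) oH)
  sequence {H = H} (o-ext oG e) oH = o-ext (sequence oG oH) (λ fs x → e fs (H fs x))

  compose : ∀ {k n} {F : Op k} {Gs : Fin k → Op n} → O[ 𝓕 ] k F → (∀ i → O[ 𝓕 ] n (Gs i)) →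
            O[ 𝓕 ] n (λ fs → F (λ i → Gs i fs))
  compose o-id            oGs = o-id
  compose (o-app j oF)    oGs = sequence (oGs j) (compose oF oGs)
  compose (o-sub a a∈ os) oGs = o-sub a a∈ (λ i → compose (os i) oGs)
  compose {Gs = Gs} (o-ext oF e) oGs = o-ext (compose oF oGs) (λ fs x → e (λ i → Gs i fs) x)

module Closure (𝓕 : FunClass) (ext : Extensional 𝓕) (ini : InitialIn 𝓕)
               (cs : ClosedSubst 𝓕) (cb : ClosedBMin 𝓕) where

  ∈-ext : ∀ {m} {f g : T m} → 𝓕 m f → (∀ v → f v ≡ g v) → 𝓕 m g
  ∈-ext {m} {f} {g} f∈ same = ext m f g same f∈

  proj-closed : ∀ {m} (i : Fin m) → 𝓕 m (λ v → lookup v i)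
  proj-closed = proj₁ ini _

  Explicit : ∀ {m k} → (Vec ℕ m → Vec ℕ k) → Set
  Explicit {m} P = ∀ j → 𝓕 m (λ v → lookup (P v) j)

  ∘-closed : ∀ {m k} {f : T k} {P : Vec ℕ m → Vec ℕ k} → 𝓕 k f → Explicit P → 𝓕 m (λ v → f (P v))
  ∘-closed {m} {k} {f} {P} f∈ P∈ =
    ∈-ext (cs k m f (λ j v → lookup (P v) j) f∈ P∈) (λ v → cong f (tabulate∘lookup (P v)))

  unary-closed : ∀ {m} {h : T 1} {p : T m} → 𝓕 1 h → 𝓕 m p → 𝓕 m (λ v → h (p v ∷ []))
  unary-closed {p = p} h∈ p∈ = ∘-closed {P = λ v → p v ∷ []} h∈ λ { zero → p∈ }

  binary-closed : ∀ {m} {h : T 2} {p q : T m} → 𝓕 2 h → 𝓕 m p → 𝓕 m q → 𝓕 m (λ v → h (p v ∷ q v ∷ []))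
  binary-closed {p = p} {q} h∈ p∈ q∈ = ∘-closed {P = λ v → p v ∷ q v ∷ []} h∈ λ { zero → p∈ ; (suc zero) → q∈ }

  suc-closed : ∀ {m} {p : T m} → 𝓕 m p → 𝓕 m (λ v → suc (p v))
  suc-closed = unary-closed (proj₁ (proj₂ ini))

  *-closed : ∀ {m} {p q : T m} → 𝓕 m p → 𝓕 m q → 𝓕 m (λ v → p v * q v)
  *-closed = binary-closed (proj₁ (proj₂ (proj₂ ini)))

  ∸-closed : ∀ {m} {p q : T m} → 𝓕 m p → 𝓕 m q → 𝓕 m (λ v → p v ∸ q v)
  ∸-closed = binary-closed (proj₁ (proj₂ (proj₂ (proj₂ ini))))

  one-closed : ∀ {m} → 𝓕 (suc m) (λ _ → 1)
  one-closed = suc-closed (∈-ext (∸-closed (proj-closed zero) (proj-closed zero)) (λ v → n∸n≡0 (lookup v zero)))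

  cover-closed : 𝓕 2 (λ v → cover (lookup v zero) (lookup v (suc zero)))
  cover-closed = *-closed (suc-closed (proj-closed zero)) (suc-closed (proj-closed (suc zero)))

  explicit-id : ∀ {m} → Explicit {m} (λ v → v)
  explicit-id = proj-closed

  explicit-init : ∀ {k} → Explicit {suc k} init
  explicit-init j = ∈-ext (proj-closed (inject₁ j)) (λ v → sym (lookup-init v j))

  last-closed : ∀ {k} → 𝓕 (suc k) last
  last-closed = ∈-ext (proj-closed (fromℕ _)) (λ v → sym (last-lookup v))

  explicit-∷ʳ : ∀ {m k} {P : Vec ℕ m → Vec ℕ k} {q : T m} → Explicit P → 𝓕 m q → Explicit (λ v → P v ∷ʳ q v)
  explicit-∷ʳ {P = P} {q} P∈ q∈ j′ with lastOrInit j′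
  ... | is-last   = ∈-ext q∈ (λ v → sym (lookup-∷ʳ-fromℕ (P v) (q v)))
  ... | is-init j = ∈-ext (P∈ j) (λ v → sym (lookup-∷ʳ-inject₁ (P v) (q v) j))

  explicit-update : ∀ {m} (i : Fin m) → Explicit (λ u → init u [ i ]≔ last u)
  explicit-update i j with j ≟ᶠ i
  ... | yes refl = ∈-ext last-closed (λ u → sym (lookup∘update j (init u) (last u)))
  ... | no j≢i   = ∈-ext (explicit-init j) (λ u → sym (lookup∘update′ j≢i (init u) (last u)))

  plug-closed : ∀ {m} {G : Family m} {q : T m} → 𝓕 (suc m) (uncurryʳ G) → 𝓕 m q → 𝓕 m (λ v → G v (q v))
  plug-closed {G = G} {q} G∈ q∈ =
    ∈-ext (∘-closed {P = λ v → v ∷ʳ q v} G∈ (explicit-∷ʳ {P = λ v → v} explicit-id q∈))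
          (λ v → uncurryʳ-∷ʳ G v (q v))

  reindex-closed : ∀ {m k} {G : Family m} {P : Vec ℕ k → Vec ℕ m} → 𝓕 (suc m) (uncurryʳ G) → Explicit P →
                   𝓕 (suc k) (uncurryʳ (λ u → G (P u)))
  reindex-closed {G = G} {P} G∈ P∈ =
    ∈-ext (∘-closed {P = λ u → P (init u) ∷ʳ last u} G∈
                     (explicit-∷ʳ {P = λ u → P (init u)} (λ j → ∘-closed {P = init} (P∈ j) explicit-init) last-closed))
          (λ u → uncurryʳ-∷ʳ G (P (init u)) (last u))

  bmin-closed : ∀ {m} {G : Family m} {q : T m} → 𝓕 (suc m) (uncurryʳ G) → 𝓕 m q → 𝓕 m (λ v → bmin (G v) (q v))
  bmin-closed {m} {G} G∈ = plug-closed {G = λ v → bmin (G v)} minimised∈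
    where
    minimised∈ : 𝓕 (suc m) (uncurryʳ (λ v → bmin (G v)))
    minimised∈ = ∈-ext (cb m (uncurryʳ G) G∈) (λ u → bmin-cong (uncurryʳ-∷ʳ G (init u)) (last u))

  argmax-closed : ∀ {m} {G : Family m} {w : T m} → 𝓕 (suc m) (uncurryʳ G) → 𝓕 m w →
                  𝓕 m (λ v → argmax (G v) (w v))
  argmax-closed {m} {G} {w} G∈ w∈ = bmin-closed {G = λ v → notMaximal (G v) (w v)} notMaximal∈ w∈
    where
    -- with F = G v, the values F y and F z as functions of u = (v, z, y)
    value-y∈ : 𝓕 (suc (suc m)) (λ u → G (init (init u)) (last u))
    value-y∈ = reindex-closed {G = G} {P = init} G∈ explicit-init
    value-z∈ : 𝓕 (suc (suc m)) (λ u → G (init (init u)) (last (init u)))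
    value-z∈ = ∘-closed {f = uncurryʳ G} {P = init} G∈ explicit-init
    exceeds∈ : 𝓕 (suc (suc m)) (uncurryʳ (λ u → exceeds (G (init u)) (last u)))
    exceeds∈ = ∸-closed {p = λ _ → 1} one-closed (∸-closed {q = λ u → G (init (init u)) (last (init u))} value-y∈ value-z∈)
    bound∈ : 𝓕 (suc m) (λ u → w (init u))
    bound∈ = ∘-closed {f = w} {P = init} w∈ explicit-init
    notMaximal∈ : 𝓕 (suc m) (uncurryʳ (λ v → notMaximal (G v) (w v)))
    notMaximal∈ = ∸-closed {p = λ u → suc (w (init u))} (suc-closed bound∈)
                    (bmin-closed {G = λ u → exceeds (G (init u)) (last u)} {q = λ u → w (init u)} exceeds∈ bound∈)

  coordinate-max : ∀ {m} {a : T m} → 𝓕 m a → ∀ i →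
                   Σ (T m) λ b → 𝓕 m b × (∀ v z → z ≤ lookup v i → a (v [ i ]≔ z) ≤ b v)
  coordinate-max {m} {a} a∈ i =
    maximum , maximum∈ , λ v z z≤vᵢ → argmax-max (G v) (lookup v i) z z≤vᵢ
    where
    G : Family m
    G v z = a (v [ i ]≔ z)
    G∈ : 𝓕 (suc m) (uncurryʳ G)
    G∈ = ∘-closed {f = a} {P = λ u → init u [ i ]≔ last u} a∈ (explicit-update i)
    maximum : T m
    maximum v = G v (argmax (G v) (lookup v i))
    maximum∈ : 𝓕 m maximum
    maximum∈ = plug-closed {G = G} {q = λ v → argmax (G v) (lookup v i)} G∈
                 (argmax-closed {G = G} {w = λ v → lookup v i} G∈ (proj-closed i))

  majorant-on : ∀ {m} {a : T m} (L : List (Fin m)) → 𝓕 m a →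
                Σ (T m) λ h → 𝓕 m h × (∀ v w → w ≤ᵛ v → DiffersOnlyOn L w v → a w ≤ h v)
  majorant-on {a = a} [] a∈ = a , a∈ , λ v w _ diff → ≤-reflexive (cong a (differs-none diff))
  majorant-on (i ∷ L) a∈ =
    let h , h∈ , h-maj = majorant-on L a∈
        b , b∈ , b-max = coordinate-max h∈ i
    -- pass from v to v[i ≔ wᵢ], majorised by b, and from there to w, majorised by h
    in b , b∈ , λ v w w≤v diff →
      ≤-trans (h-maj (v [ i ]≔ lookup w i) w (≤ᵛ-update w v i w≤v) (differs-update w v i L diff))
              (b-max v (lookup w i) (w≤v i))

  box-majorant : ∀ {m} {a : T m} → 𝓕 m a → Σ (T m) λ h → 𝓕 m h × (∀ v w → w ≤ᵛ v → a w ≤ h v)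
  box-majorant {m} a∈ =
    let h , h∈ , h-maj = majorant-on (allFin m) a∈
    in h , h∈ , λ v w w≤v → h-maj v w w≤v (λ j → inj₁ (∈-allFin j))

module Operators (𝓕 : FunClass) (ext : Extensional 𝓕) (ini : InitialIn 𝓕)
                 (cs : ClosedSubst 𝓕) (cb : ClosedBMin 𝓕) where

  open Closure 𝓕 ext ini cs cb

  apply-closed : ∀ {m n} (fs : Fin n → T (suc m)) → (∀ i → 𝓕 (suc m) (fs i)) → {F : Op n} → O[ 𝓕 ] n F →
                 𝓕 (suc m) (λ v → F (λ i t → fs i (init v ∷ʳ t)) (last v))
  apply-closed fs fs∈ o-id            = last-closed
  apply-closed fs fs∈ (o-app j o)     = ∘-closed (fs∈ j) (explicit-∷ʳ {P = init} explicit-init (apply-closed fs fs∈ o))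
  apply-closed fs fs∈ (o-sub a a∈ os) = cs _ _ a _ a∈ (λ i → apply-closed fs fs∈ (os i))
  apply-closed fs fs∈ (o-ext o e)     = ∈-ext (apply-closed fs fs∈ o) (λ v → e _ _)

  cover-op : ∀ {A B : Op 1} → O[ 𝓕 ] 1 A → O[ 𝓕 ] 1 B → O[ 𝓕 ] 1 (λ gs x → cover (A gs x) (B gs x))
  cover-op {A} {B} oA oB =
    o-sub (λ v → cover (lookup v zero) (lookup v (suc zero))) {Fs = λ { zero → A ; (suc zero) → B ; (suc (suc ())) }}
          cover-closed (λ { zero → oA ; (suc zero) → oB ; (suc (suc ())) })

  coverAll-op : ∀ {m} {As : Fin m → Op 1} → (∀ i → O[ 𝓕 ] 1 (As i)) →
                O[ 𝓕 ] 1 (λ gs x → coverAll x (λ i → As i gs x))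
  coverAll-op {zero}  oAs = o-id
  coverAll-op {suc m} oAs = cover-op (oAs zero) (coverAll-op (λ i → oAs (suc i)))

  record Modulus {n} (F : Op n) : Set where
    field
      Ω bound : Op 1
      Ω∈ : O[ 𝓕 ] 1 Ω
      bound∈ : O[ 𝓕 ] 1 bound
      bounds : ∀ x g → Monotone g → ∀ fs → Majorized fs g → F fs x ≤ bound (λ _ → g) x
      determines : ∀ x (g : ℕ → ℕ) → Monotone g → (fs fs′ : Fin n → ℕ → ℕ) →
                   Majorized fs g → Majorized fs′ g → Agree≤ (Ω (λ _ → g) x) fs fs′ → F fs x ≡ F fs′ x

  modulus-id : ∀ {n} → Modulus {n} (λ fs x → x)
  modulus-id = record
    { Ω = λ _ x → x ; bound = λ _ x → x ; Ω∈ = o-id ; bound∈ = o-id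
    ; bounds = λ _ _ _ _ _ → ≤-refl ; determines = λ _ _ _ _ _ _ _ _ → refl }

  -- fs j is evaluated at F₀(f⃗)(x) ≤ B(g)(x): agreement up to that bound and
  -- up to the modulus of F₀ suffices, and g bounds the result by monotonicity.
  modulus-app : ∀ {n} {F₀ : Op n} (j : Fin n) → Modulus F₀ → Modulus (λ fs x → fs j (F₀ fs x))
  modulus-app {F₀ = F₀} j M = record
    { Ω = λ gs x → cover (Ω gs x) (bound gs x) ; bound = λ gs x → gs zero (bound gs x)
    ; Ω∈ = cover-op Ω∈ bound∈ ; bound∈ = o-app zero bound∈
    ; bounds = λ x g g-mono fs fs≤g → ≤-trans (fs≤g j (F₀ fs x)) (g-mono (bounds x g g-mono fs fs≤g))
    ; determines = λ x g g-mono fs fs′ fs≤g fs′≤g agree →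
        trans (agree j (F₀ fs x) (≤-trans (bounds x g g-mono fs fs≤g) (cover-≥ʳ (Ω (λ _ → g) x) _)))
              (cong (fs′ j) (determines x g g-mono fs fs′ fs≤g fs′≤g (agree-≤ (cover-≥ˡ _ (bound (λ _ → g) x)) agree)))
    }
    where open Modulus M

  -- The arguments of a are bounded by the bounds of the Fᵢ, so a box majorant
  -- of a bounds the value; the moduli of the Fᵢ are combined by coverAll.
  modulus-sub : ∀ {m n} (a : T m) {Fs : Fin m → Op n} → 𝓕 m a → (∀ i → Modulus (Fs i)) →
                Modulus (λ fs x → a (tabulate (λ i → Fs i fs x)))
  modulus-sub a a∈ Ms =
    let h , h∈ , h-maj = box-majorant a∈ in record
    { Ω = λ gs x → coverAll x (λ i → Ω i gs x) ; bound = λ gs x → h (tabulate (λ i → bound i gs x))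
    ; Ω∈ = coverAll-op Ω∈ ; bound∈ = o-sub h h∈ bound∈
    ; bounds = λ x g g-mono fs fs≤g → h-maj _ _ (tabulate-≤ᵛ (λ i → bounds i x g g-mono fs fs≤g))
    ; determines = λ x g g-mono fs fs′ fs≤g fs′≤g agree → cong a (tabulate-cong λ i →
        determines i x g g-mono fs fs′ fs≤g fs′≤g (agree-≤ (coverAll-≥ x (λ i → Ω i (λ _ → g) x) i) agree))
    }
    where open module Mᵢ i = Modulus (Ms i)

  modulus-ext : ∀ {n} {F G : Op n} → Modulus F → (∀ fs x → F fs x ≡ G fs x) → Modulus G
  modulus-ext M F≗G = record
    { Ω = Ω ; bound = bound ; Ω∈ = Ω∈ ; bound∈ = bound∈
    ; bounds = λ x g g-mono fs fs≤g → ≤-trans (≤-reflexive (sym (F≗G fs x))) (bounds x g g-mono fs fs≤g)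
    ; determines = λ x g g-mono fs fs′ fs≤g fs′≤g agree →
        trans (sym (F≗G fs x)) (trans (determines x g g-mono fs fs′ fs≤g fs′≤g agree) (F≗G fs′ x))
    }
    where open Modulus M

  modulus : ∀ {n} {F : Op n} → O[ 𝓕 ] n F → Modulus F
  modulus o-id            = modulus-id
  modulus (o-app j o)     = modulus-app j (modulus o)
  modulus (o-sub a a∈ os) = modulus-sub a a∈ (λ i → modulus (os i))
  modulus (o-ext o e)     = modulus-ext (modulus o) e

proposition1p2 : (𝓕 : FunClass) → Extensional 𝓕 → InitialIn 𝓕 → ClosedSubst 𝓕 → ClosedBMin 𝓕 →
    Acceptable 𝓕 O[ 𝓕 ]
proposition1p2 𝓕 ext ini cs cb = record
  { c1 = ini
  ; c2-subst = cs
  ; c2-bmin = cb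
  ; c3 = λ _ _ → continuous
  ; c4 = λ _ → o-id
  ; c5 = λ _ _ j → o-app j
  ; c6 = λ _ _ a _ → o-sub a
  ; c7 = λ _ _ _ _ → compose
  ; c8 = λ _ _ fs _ fs∈ → apply-closed fs fs∈
  ; c9 = λ _ _ o → let open Modulus (modulus o) in Ω , Ω∈ , determines
  }
  where open Operators 𝓕 ext ini cs cb
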